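{- Consider formulas of the propositional provability calculus in a single propositional variable $p$. Up to equivalence in the logic $L\mathfrak{B}_2$, there are exactly 64 such formulas; equivalently, exactly 64 distinct unary operations on $\mathfrak{B}_2$ are induced by formulas in one variable.
   Context: Formulas of the propositional provability calculus are built from propositional variables using $\&,\vee,\supset,\neg$ and the unary modal connective $\Delta$. The algebra $\mathfrak{B}_2=(\{\mathbb{0},\rho,\sigma,\mathbb{1}\};\&,\vee,\supset,\neg,\Delta)$ is the four-element Boolean algebra with least element $\mathbb{0}$, greatest element $\mathbb{1}$ and atoms $\rho,\sigma$ (so $\neg\rho=\sigma$), with usual Boolean operations and $\Delta\mathbb{0}=\Delta\rho=\sigma$, $\Delta\sigma=\Delta\mathbb{1}=\mathbb{1}$. Formulas are evaluated on $\mathfrak{B}_2$ by interpreting variables as elements and connectives as the corresponding operations. $L\mathfrak{B}_2$ is the set of formulas taking value $\mathbb{1}$ under every evaluation on $\mathfrak{B}_2$; formulas $A,B$ are equivalent in $L\mathfrak{B}_2$ if $(A\supset B)\&(B\supset A)\in L\mathfrak{B}_2$, i.e. they induce the same operation on $\mathfrak{B}_2$. -}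

module Defs where

open import Data.Nat using (ℕ)
open import Data.Fin using (Fin)
open import Data.Vec using (Vec; lookup)
open import Data.Product using (∃; _×_)
open import Relation.Binary.PropositionalEquality using (_≡_)

data B₂ : Set where
  𝟘 ρ σ 𝟙 : B₂

_∧ᴮ_ : B₂ → B₂ → B₂
𝟘 ∧ᴮ y = 𝟘
𝟙 ∧ᴮ y = y
ρ ∧ᴮ 𝟘 = 𝟘
ρ ∧ᴮ ρ = ρ
ρ ∧ᴮ σ = 𝟘
ρ ∧ᴮ 𝟙 = ρ
σ ∧ᴮ 𝟘 = 𝟘
σ ∧ᴮ ρ = 𝟘
σ ∧ᴮ σ = σ
σ ∧ᴮ 𝟙 = σ

¬ᴮ_ : B₂ → B₂
¬ᴮ 𝟘 = 𝟙
¬ᴮ ρ = σ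
¬ᴮ σ = ρ
¬ᴮ 𝟙 = 𝟘

_∨ᴮ_ : B₂ → B₂ → B₂
x ∨ᴮ y = ¬ᴮ ((¬ᴮ x) ∧ᴮ (¬ᴮ y))

_⊃ᴮ_ : B₂ → B₂ → B₂
x ⊃ᴮ y = (¬ᴮ x) ∨ᴮ y

Δᴮ : B₂ → B₂
Δᴮ 𝟘 = σ
Δᴮ ρ = σ
Δᴮ σ = 𝟙
Δᴮ 𝟙 = 𝟙

data Formula : Set where
  p   : Formula
  _&_ : Formula → Formula → Formula
  _∨_ : Formula → Formula → Formula
  _⊃_ : Formula → Formula → Formula
  ¬_  : Formula → Formula
  Δ   : Formula → Formula

⟦_⟧ : Formula → B₂ → B₂
⟦ p ⟧ x = x
⟦ A & B ⟧ x = ⟦ A ⟧ x ∧ᴮ ⟦ B ⟧ x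
⟦ A ∨ B ⟧ x = ⟦ A ⟧ x ∨ᴮ ⟦ B ⟧ x
⟦ A ⊃ B ⟧ x = ⟦ A ⟧ x ⊃ᴮ ⟦ B ⟧ x
⟦ ¬ A ⟧ x = ¬ᴮ (⟦ A ⟧ x)
⟦ Δ A ⟧ x = Δᴮ (⟦ A ⟧ x)

_∈L𝔅₂ : Formula → Set
A ∈L𝔅₂ = ∀ (x : B₂) → ⟦ A ⟧ x ≡ 𝟙

_≈_ : Formula → Formula → Set
A ≈ B = ((A ⊃ B) & (B ⊃ A)) ∈L𝔅₂

ExactlyClasses : ℕ → Set
ExactlyClasses n =
  ∃ λ (F : Vec Formula n) →
    (∀ (i j : Fin n) → lookup F i ≈ lookup F j → i ≡ j)
    × (∀ (A : Formula) → ∃ λ (i : Fin n) → A ≈ lookup F i)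

-- A formula in p induces a unary operation on 𝔅₂, determined by its table of
-- four values, and two formulas are equivalent iff their tables coincide.  The
-- induced operations form the closure of the identity under the pointwise
-- operations of 𝔅₂.  Sixty-four explicit formulas have pairwise distinct
-- tables, and this set of tables is closed under ¬, Δ, &, ∨ and ⊃, so it
-- contains the table of every formula.
module Submission where

open import Defs
open import Data.Fin using (Fin; #_)
open import Data.Product using (∃; _,_)
open import Data.Vec using (Vec; []; _∷_; lookup; map; zipWith)
open import Data.Vec.Properties using (map-cong; lookup-map; ≡-dec)
open import Data.Vec.Relation.Unary.All as All using (All; all?)
open import Data.Vec.Relation.Unary.Any using (index)
open import Data.Vec.Relation.Unary.Any.Properties using (lookup-index)
open import Data.Vec.Relation.Unary.AllPairs using (allPairs?)
open import Data.Vec.Relation.Unary.Unique.Propositional using (Unique)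
open import Data.Vec.Relation.Unary.Unique.Propositional.Properties using (lookup-injective)
open import Relation.Binary.Definitions using (DecidableEquality)
open import Relation.Binary.PropositionalEquality using (_≡_; refl; sym; trans; cong; subst; module ≡-Reasoning)
open import Relation.Nullary using (Dec; yes; no; ¬?)
open import Relation.Nullary.Decidable using (from-yes)

_≟ᴮ_ : DecidableEquality B₂
𝟘 ≟ᴮ 𝟘 = yes refl
𝟘 ≟ᴮ ρ = no λ ()
𝟘 ≟ᴮ σ = no λ ()
𝟘 ≟ᴮ 𝟙 = no λ ()
ρ ≟ᴮ 𝟘 = no λ ()
ρ ≟ᴮ ρ = yes refl
ρ ≟ᴮ σ = no λ ()
ρ ≟ᴮ 𝟙 = no λ ()
σ ≟ᴮ 𝟘 = no λ ()
σ ≟ᴮ ρ = no λ ()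
σ ≟ᴮ σ = yes refl
σ ≟ᴮ 𝟙 = no λ ()
𝟙 ≟ᴮ 𝟘 = no λ ()
𝟙 ≟ᴮ ρ = no λ ()
𝟙 ≟ᴮ σ = no λ ()
𝟙 ≟ᴮ 𝟙 = yes refl

_⇔ᴮ_ : B₂ → B₂ → B₂
a ⇔ᴮ b = (a ⊃ᴮ b) ∧ᴮ (b ⊃ᴮ a)

⇔ᴮ-refl : ∀ a → a ⇔ᴮ a ≡ 𝟙
⇔ᴮ-refl 𝟘 = refl
⇔ᴮ-refl ρ = refl
⇔ᴮ-refl σ = refl
⇔ᴮ-refl 𝟙 = refl

⇔ᴮ≡𝟙⇒≡ : ∀ a b → a ⇔ᴮ b ≡ 𝟙 → a ≡ b
⇔ᴮ≡𝟙⇒≡ 𝟘 𝟘 _ = refl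
⇔ᴮ≡𝟙⇒≡ 𝟘 ρ ()
⇔ᴮ≡𝟙⇒≡ 𝟘 σ ()
⇔ᴮ≡𝟙⇒≡ 𝟘 𝟙 ()
⇔ᴮ≡𝟙⇒≡ ρ 𝟘 ()
⇔ᴮ≡𝟙⇒≡ ρ ρ _ = refl
⇔ᴮ≡𝟙⇒≡ ρ σ ()
⇔ᴮ≡𝟙⇒≡ ρ 𝟙 ()
⇔ᴮ≡𝟙⇒≡ σ 𝟘 ()
⇔ᴮ≡𝟙⇒≡ σ ρ ()
⇔ᴮ≡𝟙⇒≡ σ σ _ = refl
⇔ᴮ≡𝟙⇒≡ σ 𝟙 ()
⇔ᴮ≡𝟙⇒≡ 𝟙 𝟘 ()
⇔ᴮ≡𝟙⇒≡ 𝟙 ρ ()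
⇔ᴮ≡𝟙⇒≡ 𝟙 σ ()
⇔ᴮ≡𝟙⇒≡ 𝟙 𝟙 _ = refl

Table : Set
Table = Vec B₂ 4

_≟ᵀ_ : DecidableEquality Table
_≟ᵀ_ = ≡-dec _≟ᴮ_

open import Data.Vec.Membership.DecPropositional _≟ᵀ_ using (_∈_; _∈?_)

elements : Vec B₂ 4
elements = 𝟘 ∷ ρ ∷ σ ∷ 𝟙 ∷ []

tabulateᴮ : (B₂ → B₂) → Table
tabulateᴮ f = map f elements

tabulateᴮ-cong : ∀ {f g} → (∀ x → f x ≡ g x) → tabulateᴮ f ≡ tabulateᴮ g
tabulateᴮ-cong f≗g = map-cong f≗g elements

tabulateᴮ-injective : ∀ {f g} → tabulateᴮ f ≡ tabulateᴮ g → ∀ x → f x ≡ g x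
tabulateᴮ-injective eq 𝟘 = cong (λ t → lookup t (# 0)) eq
tabulateᴮ-injective eq ρ = cong (λ t → lookup t (# 1)) eq
tabulateᴮ-injective eq σ = cong (λ t → lookup t (# 2)) eq
tabulateᴮ-injective eq 𝟙 = cong (λ t → lookup t (# 3)) eq

table : Formula → Table
table A = tabulateᴮ ⟦ A ⟧

≈⇒table≡ : ∀ {A B} → A ≈ B → table A ≡ table B
≈⇒table≡ {A} {B} A≈B = tabulateᴮ-cong {⟦ A ⟧} {⟦ B ⟧} λ x → ⇔ᴮ≡𝟙⇒≡ (⟦ A ⟧ x) (⟦ B ⟧ x) (A≈B x)

table≡⇒≈ : ∀ {A B} → table A ≡ table B → A ≈ B
table≡⇒≈ {A} {B} eq x =
  subst (λ a → a ⇔ᴮ ⟦ B ⟧ x ≡ 𝟙) (sym (tabulateᴮ-injective {⟦ A ⟧} {⟦ B ⟧} eq x)) (⇔ᴮ-refl (⟦ B ⟧ x))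

record ClosedUnderConnectives (P : Table → Set) : Set where
  field
    identity : P elements
    ¬-closed : ∀ {u} → P u → P (map ¬ᴮ_ u)
    Δ-closed : ∀ {u} → P u → P (map Δᴮ u)
    &-closed : ∀ {u v} → P u → P v → P (zipWith _∧ᴮ_ u v)
    ∨-closed : ∀ {u v} → P u → P v → P (zipWith _∨ᴮ_ u v)
    ⊃-closed : ∀ {u v} → P u → P v → P (zipWith _⊃ᴮ_ u v)

module _ {P : Table → Set} (closed : ClosedUnderConnectives P) where
  open ClosedUnderConnectives closed

  table-closed : ∀ A → P (table A)
  table-closed p = identity
  table-closed (A & B) = &-closed (table-closed A) (table-closed B)
  table-closed (A ∨ B) = ∨-closed (table-closed A) (table-closed B)
  table-closed (A ⊃ B) = ⊃-closed (table-closed A) (table-closed B)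
  table-closed (¬ A) = ¬-closed (table-closed A)
  table-closed (Δ A) = Δ-closed (table-closed A)

module FiniteClosure {n} (ts : Vec Table n) where
  MapClosed : (B₂ → B₂) → Set
  MapClosed f = All (λ u → map f u ∈ ts) ts

  mapClosed? : ∀ f → Dec (MapClosed f)
  mapClosed? f = all? (λ u → map f u ∈? ts) ts

  ZipWithClosed : (B₂ → B₂ → B₂) → Set
  ZipWithClosed f = All (λ u → All (λ v → zipWith f u v ∈ ts) ts) ts

  zipWithClosed? : ∀ f → Dec (ZipWithClosed f)
  zipWithClosed? f = all? (λ u → all? (λ v → zipWith f u v ∈? ts) ts) ts

  mapClosed⇒closed : ∀ {f} → MapClosed f → ∀ {u} → u ∈ ts → map f u ∈ ts
  mapClosed⇒closed = All.lookup

  zipWithClosed⇒closed : ∀ {f} → ZipWithClosed f → ∀ {u v} → u ∈ ts → v ∈ ts → zipWith f u v ∈ ts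
  zipWithClosed⇒closed closed u∈ts = All.lookup (All.lookup closed u∈ts)

representatives : Vec Formula 64
representatives =
    p
  ∷ ¬ p
  ∷ Δ p
  ∷ p ⊃ p
  ∷ p & (¬ p)
  ∷ p & Δ p
  ∷ p ∨ Δ p
  ∷ p ⊃ Δ p
  ∷ Δ (¬ p)
  ∷ (¬ p) & Δ p
  ∷ ¬ Δ p
  ∷ Δ p ⊃ p
  ∷ Δ p ⊃ (¬ p)
  ∷ p & Δ (¬ p)
  ∷ p ∨ Δ (¬ p)
  ∷ p ⊃ Δ (¬ p)
  ∷ p & (¬ Δ p)
  ∷ (¬ p) & Δ (¬ p)
  ∷ (¬ p) & (¬ Δ p)
  ∷ Δ p & Δ (¬ p)
  ∷ (p & Δ p) & Δ (¬ p)
  ∷ (p ∨ Δ p) ⊃ (p & Δ p)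
  ∷ (p ∨ Δ p) & Δ (¬ p)
  ∷ (p ∨ Δ p) & (Δ p ⊃ (¬ p))
  ∷ (p ⊃ Δ p) & Δ (¬ p)
  ∷ ¬ Δ (¬ p)
  ∷ Δ (¬ p) ⊃ p
  ∷ Δ (¬ p) ⊃ (¬ p)
  ∷ Δ (¬ p) ⊃ (p & Δ p)
  ∷ Δ (¬ p) & ((¬ p) & Δ p)
  ∷ Δ (¬ p) ⊃ ((¬ p) & Δ p)
  ∷ Δ (¬ p) ⊃ (¬ Δ p)
  ∷ Δ (¬ p) & (Δ p ⊃ p)
  ∷ Δ (¬ p) ⊃ (Δ p ⊃ p)
  ∷ Δ (¬ p) & (Δ p ⊃ (¬ p))
  ∷ Δ (¬ p) ⊃ (Δ p ⊃ (¬ p))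
  ∷ p ∨ (Δ p & Δ (¬ p))
  ∷ p ⊃ (Δ p & Δ (¬ p))
  ∷ p & (¬ Δ (¬ p))
  ∷ p & (Δ (¬ p) ⊃ (¬ Δ p))
  ∷ (¬ p) & (¬ Δ (¬ p))
  ∷ (¬ p) & (Δ (¬ p) ⊃ (¬ Δ p))
  ∷ Δ p & (p ∨ Δ (¬ p))
  ∷ Δ p & (p ⊃ Δ (¬ p))
  ∷ (p & Δ p) ∨ ((¬ p) & Δ (¬ p))
  ∷ (p ∨ Δ p) & (p ⊃ Δ (¬ p))
  ∷ (p ∨ Δ p) ⊃ ((p & Δ p) & Δ (¬ p))
  ∷ (p ∨ Δ p) ⊃ (¬ Δ (¬ p))
  ∷ (p ∨ Δ p) ⊃ (Δ (¬ p) ⊃ (p & Δ p))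
  ∷ (p ∨ Δ p) & (Δ (¬ p) ⊃ (¬ Δ p))
  ∷ (p ∨ Δ p) & (Δ (¬ p) & (Δ p ⊃ (¬ p)))
  ∷ (p ∨ Δ p) & (Δ (¬ p) ⊃ (Δ p ⊃ (¬ p)))
  ∷ (Δ p ⊃ p) & (Δ (¬ p) ⊃ (¬ p))
  ∷ (Δ p ⊃ p) & (Δ (¬ p) ⊃ (¬ Δ p))
  ∷ (Δ p ⊃ (¬ p)) & (Δ (¬ p) ⊃ p)
  ∷ (Δ p ⊃ (¬ p)) & (Δ (¬ p) ⊃ (¬ Δ p))
  ∷ (p ∨ Δ (¬ p)) ⊃ (p & Δ (¬ p))
  ∷ (p ∨ Δ (¬ p)) ⊃ ((p & Δ p) & Δ (¬ p))
  ∷ (p ∨ Δ (¬ p)) & (Δ (¬ p) ⊃ (¬ p))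
  ∷ (p ∨ Δ (¬ p)) & (Δ (¬ p) ⊃ ((¬ p) & Δ p))
  ∷ (p ∨ Δ (¬ p)) ⊃ (Δ (¬ p) & (Δ p ⊃ p))
  ∷ (p ∨ Δ (¬ p)) & (Δ (¬ p) ⊃ (Δ p ⊃ (¬ p)))
  ∷ (p ∨ Δ p) ⊃ ((p ∨ Δ (¬ p)) ⊃ ((p & Δ p) & Δ (¬ p)))
  ∷ (p ∨ Δ p) & ((p ∨ Δ (¬ p)) & (Δ (¬ p) ⊃ (Δ p ⊃ (¬ p))))
  ∷ []

tables : Vec Table 64
tables = map table representatives

open FiniteClosure tables

tables-unique : Unique tables
tables-unique = from-yes (allPairs? (λ u v → ¬? (u ≟ᵀ v)) tables)

tables-closed : ClosedUnderConnectives (_∈ tables)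
tables-closed = record
  { identity = from-yes (elements ∈? tables)
  ; ¬-closed = mapClosed⇒closed (from-yes (mapClosed? ¬ᴮ_))
  ; Δ-closed = mapClosed⇒closed (from-yes (mapClosed? Δᴮ))
  ; &-closed = zipWithClosed⇒closed (from-yes (zipWithClosed? _∧ᴮ_))
  ; ∨-closed = zipWithClosed⇒closed (from-yes (zipWithClosed? _∨ᴮ_))
  ; ⊃-closed = zipWithClosed⇒closed (from-yes (zipWithClosed? _⊃ᴮ_))
  }

lookup-tables : ∀ i → lookup tables i ≡ table (lookup representatives i)
lookup-tables i = lookup-map i table representatives

proposition1 : ExactlyClasses 64
proposition1 = representatives , inequivalent , complete
  where
  inequivalent : ∀ i j → lookup representatives i ≈ lookup representatives j → i ≡ j
  inequivalent i j Aᵢ≈Aⱼ = lookup-injective tables-unique i j (begin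
    lookup tables i ≡⟨ lookup-tables i ⟩
    table Aᵢ        ≡⟨ ≈⇒table≡ {Aᵢ} {Aⱼ} Aᵢ≈Aⱼ ⟩
    table Aⱼ        ≡⟨ lookup-tables j ⟨
    lookup tables j ∎)
    where
    open ≡-Reasoning

    Aᵢ Aⱼ : Formula
    Aᵢ = lookup representatives i
    Aⱼ = lookup representatives j

  complete : ∀ A → ∃ λ i → A ≈ lookup representatives i
  complete A = i , table≡⇒≈ {A} {lookup representatives i} (trans (lookup-index A∈) (lookup-tables i))
    where
    A∈ : table A ∈ tables
    A∈ = table-closed tables-closed A

    i : Fin 64
    i = index A∈
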